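{- Let $\mathcal{I}=(\mathcal{N},W)$ be an instance, let $\mathcal{G}$ be a feasible chain for $\mathcal{I}$, and let $\mathcal{R}$ be a feasible chain for the residual instance $\mathcal{I}^{ -\mathcal{G}}$. Then $\mathcal{G}\cup\mathcal{R}$ is a feasible chain for $\mathcal{I}$ with profit $\Phi(\mathcal{G}\cup\mathcal{R})=\Phi(\mathcal{G})+\Phi(\mathcal{R})$.
   Context: An instance $\mathcal{I}=(\mathcal{N},W)$ of generalized incremental knapsack consists of an item set $\mathcal{N}$ with strictly positive weights $w_i$, $T$ periods with capacities $W=(W_1,\dots,W_T)$, $W_1\le\cdots\le W_T$, and non-negative profits $p_{it}$ (weights, $T$ and profits are shared by all instances considered). A chain is $\mathcal{S}=(S_1,\dots,S_T)$ with $S_1\subseteq\cdots\subseteq S_T\subseteq\mathcal{N}$; it is feasible if $w(S_t)\le W_t$ for all $t$; its profit is $\Phi(\mathcal{S})=\sum_{t}\sum_{i\in S_t\setminus S_{t-1}}p_{it}$, $S_0=\emptyset$. The union of chains is $\mathcal{S}\cup\mathcal{G}=(S_1\cup G_1,\dots,S_T\cup G_T)$. For a feasible chain $\mathcal{G}=(G_1,\dots,G_T)$ for $\mathcal{I}$, the residual instance $\mathcal{I}^{ -\mathcal{G}}=(\mathcal{N}\setminus G_T,W^{ -\mathcal{G}})$ has capacities $W^{ -\mathcal{G}}_t=\min_{t\le\tau\le T}(W_\tau-w(G_\tau))$, with the same weights and profits.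
   Formalization: The item weights $w_i$, the capacities and the profits $p_{it}$ are all rational numbers. -}

module Defs where

open import Data.Nat using (ℕ)
open import Data.Bool using (Bool; true; false; if_then_else_)
open import Data.Fin using (Fin; zero; suc; inject₁) renaming (_≤_ to _≤ᶠ_)
open import Data.Fin.Properties using () renaming (_≤?_ to _≤ᶠ?_)
open import Data.Fin.Subset using (Subset; _⊆_; _∪_; _∩_; ∁; ⊥; _∈_)
open import Data.Vec using (lookup)
open import Data.List using (List; foldr; map; filter; allFin)
open import Data.Rational using (ℚ; 0ℚ; _+_; _-_; _≤_; _<_; _⊓_)
open import Data.Product using (_×_)

sumFin : ∀ {k} → (Fin k → ℚ) → ℚ
sumFin {ℕ.zero}  f = 0ℚ
sumFin {ℕ.suc k} f = f zero + sumFin (λ i → f (suc i))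

-- Global data shared by all instances: n items (Fin n), T periods (Fin T,
-- period t+1 of the paper is Fin index t), weights and profits.
record Data (n T : ℕ) : Set where
  field
    w : Fin n → ℚ
    p : Fin n → Fin T → ℚ
    w-pos : ∀ i → 0ℚ < w i
    p-nonneg : ∀ i t → 0ℚ ≤ p i t

record Instance (n T : ℕ) : Set where
  constructor inst
  field
    items : Subset n
    cap   : Fin T → ℚ

CapMonotone : ∀ {n T} → Instance n T → Set
CapMonotone I = ∀ t t' → t ≤ᶠ t' → Instance.cap I t ≤ Instance.cap I t'

Seq : ℕ → ℕ → Set
Seq n T = Fin T → Subset n

weight : ∀ {n} → (Fin n → ℚ) → Subset n → ℚ
weight w S = sumFin (λ i → if lookup S i then w i else 0ℚ)

IsChain : ∀ {n T} → Seq n T → Set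
IsChain S = ∀ t t' → t ≤ᶠ t' → S t ⊆ S t'

-- feasible chain for an instance: a chain inside the item set (every S_t ⊆ N,
-- i.e. S_T ⊆ N) with w(S_t) ≤ W_t for all t
Feasible : ∀ {n T} → Data n T → Instance n T → Seq n T → Set
Feasible D I S =
  IsChain S × (∀ t → S t ⊆ Instance.items I)
            × (∀ t → weight (Data.w D) (S t) ≤ Instance.cap I t)

prev : ∀ {n T} → Seq n T → Fin T → Subset n
prev S zero    = ⊥
prev S (suc t) = S (inject₁ t)

profit : ∀ {n T} → Data n T → Seq n T → ℚ
profit D S = sumFin (λ t → sumFin (λ i →
  if lookup (S t ∩ ∁ (prev S t)) i then Data.p D i t else 0ℚ))

_∪ᶜ_ : ∀ {n T} → Seq n T → Seq n T → Seq n T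
(S ∪ᶜ G) t = S t ∪ G t

minFrom : ∀ {T} → (Fin T → ℚ) → Fin T → ℚ
minFrom {T} f t = foldr _⊓_ (f t) (map f (filter (t ≤ᶠ?_) (allFin T)))

residual : ∀ {n T} → Data n T → Instance n T → Seq n T → Instance n T
residual {T = ℕ.zero}  D I G = inst (Instance.items I) (λ ())
residual {T = ℕ.suc T} D I G =
  inst (Instance.items I ∩ ∁ (G (Data.Fin.fromℕ T)))
       (minFrom (λ τ → Instance.cap I τ - weight (Data.w D) (G τ)))

{-# OPTIONS --safe #-}
-- Every R_t lies in N \ G_T, hence is disjoint from every G_τ.  Disjointness makes
-- weights add, so w(G_t ∪ R_t) = w(G_t) + w(R_t) ≤ w(G_t) + W^{-G}_t ≤ W_t.  It also
-- makes the items arriving in G ∪ R at period t the disjoint union of those arriving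
-- in G and those arriving in R, so the profits add as well.
module Submission where

open import Defs
open import Data.Nat using (ℕ)
open import Data.Product using (_×_; _,_; proj₂)
open import Data.Rational using (_+_)
open import Relation.Binary.PropositionalEquality using (_≡_)

import Data.Rational.Properties as QP
open import Algebra.Properties.AbelianGroup QP.+-0-abelianGroup using (xyx⁻¹≈y)
open import Algebra.Bundles using (CommutativeMonoid)
open import Algebra.Properties.CommutativeSemigroup
  (CommutativeMonoid.commutativeSemigroup QP.+-0-commutativeMonoid) using (interchange)
open import Data.Bool using (true; false; _∧_; _∨_; not; if_then_else_)
open import Data.Empty using (⊥-elim)
open import Data.Fin using (Fin; zero; suc; fromℕ)
open import Data.Fin.Properties using (≤fromℕ; _≤?_)
open import Data.Fin.Subset using (Subset; _⊆_; _∪_; _∩_; ∁; ⊥; _∈_; _∉_)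
open import Data.Fin.Subset.Properties
  using (∉⊥; ∪-identityˡ; p∩q⊆p; x∈p∩q⁻; x∈∁p⇒x∉p; x∈p∪q⁻; x∈p∪q⁺)
open import Data.List using (List; []; _∷_; foldr; map; filter; allFin)
open import Data.Rational using (ℚ; 0ℚ; _-_; _≤_; _⊓_; -_)
open import Data.Sum using ([_,_]′) renaming (map to map⊎)
open import Data.Vec using ([]; _∷_; here; there)
open import Function using (_∘_)
open import Relation.Binary.PropositionalEquality using (refl; sym; trans; cong; cong₂; module ≡-Reasoning)

sumFin-cong : ∀ {k} {f g : Fin k → ℚ} → (∀ i → f i ≡ g i) → sumFin f ≡ sumFin g
sumFin-cong {ℕ.zero}  f≗g = refl
sumFin-cong {ℕ.suc k} f≗g = cong₂ _+_ (f≗g zero) (sumFin-cong (f≗g ∘ suc))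

sumFin-distrib-+ : ∀ {k} (f g : Fin k → ℚ) →
                   sumFin (λ i → f i + g i) ≡ sumFin f + sumFin g
sumFin-distrib-+ {ℕ.zero}  f g = sym (QP.+-identityʳ 0ℚ)
sumFin-distrib-+ {ℕ.suc k} f g = begin
  (f zero + g zero) + sumFin (λ i → f (suc i) + g (suc i))
    ≡⟨ cong ((f zero + g zero) +_) (sumFin-distrib-+ (f ∘ suc) (g ∘ suc)) ⟩
  (f zero + g zero) + (sumFin (f ∘ suc) + sumFin (g ∘ suc))
    ≡⟨ interchange (f zero) (g zero) _ _ ⟩
  (f zero + sumFin (f ∘ suc)) + (g zero + sumFin (g ∘ suc))
    ∎
  where open ≡-Reasoning

+-[-]-cancel : ∀ x y → x + (y - x) ≡ y
+-[-]-cancel x y = trans (sym (QP.+-assoc x y (- x))) (xyx⁻¹≈y x y)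

foldr-⊓-≤ : ∀ e (xs : List ℚ) → foldr _⊓_ e xs ≤ e
foldr-⊓-≤ e []       = QP.≤-refl
foldr-⊓-≤ e (x ∷ xs) = QP.≤-trans (QP.p⊓q≤q x _) (foldr-⊓-≤ e xs)

minFrom-≤ : ∀ {T} (f : Fin T → ℚ) t → minFrom f t ≤ f t
minFrom-≤ {T} f t = foldr-⊓-≤ (f t) (map f (filter (t ≤?_) (allFin T)))

Disjoint : ∀ {n} → Subset n → Subset n → Set
Disjoint A B = ∀ {i} → i ∈ A → i ∉ B

Disjoint-sym : ∀ {n} {A B : Subset n} → Disjoint A B → Disjoint B A
Disjoint-sym A#B i∈B i∈A = A#B i∈A i∈B

Disjoint-mono : ∀ {n} {A A' B B' : Subset n} → A' ⊆ A → B' ⊆ B → Disjoint A B → Disjoint A' B'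
Disjoint-mono A'⊆A B'⊆B A#B i∈A' i∈B' = A#B (A'⊆A i∈A') (B'⊆B i∈B')

Disjoint-head : ∀ {n a b} {A B : Subset n} → Disjoint (a ∷ A) (b ∷ B) → a ∧ b ≡ false
Disjoint-head {a = true}  {true}  a#b = ⊥-elim (a#b here here)
Disjoint-head {a = true}  {false} a#b = refl
Disjoint-head {a = false}         a#b = refl

Disjoint-tail : ∀ {n a b} {A B : Subset n} → Disjoint (a ∷ A) (b ∷ B) → Disjoint A B
Disjoint-tail a#b i∈A i∈B = a#b (there i∈A) (there i∈B)

∪-lub : ∀ {n} {A B C : Subset n} → A ⊆ C → B ⊆ C → A ∪ B ⊆ C
∪-lub {A = A} {B} A⊆C B⊆C = [ A⊆C , B⊆C ]′ ∘ x∈p∪q⁻ A B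

if-∨ : ∀ a b (x : ℚ) → a ∧ b ≡ false →
       (if a ∨ b then x else 0ℚ) ≡ (if a then x else 0ℚ) + (if b then x else 0ℚ)
if-∨ true  true  x ()
if-∨ true  false x _ = sym (QP.+-identityʳ x)
if-∨ false b     x _ = sym (QP.+-identityˡ _)

weight-∪ : ∀ {n} (f : Fin n → ℚ) {A B : Subset n} → Disjoint A B →
           weight f (A ∪ B) ≡ weight f A + weight f B
weight-∪ f {[]}    {[]}    _   = sym (QP.+-identityʳ 0ℚ)
weight-∪ f {a ∷ A} {b ∷ B} A#B = begin
  (if a ∨ b then f zero else 0ℚ) + weight (f ∘ suc) (A ∪ B)
    ≡⟨ cong₂ _+_ (if-∨ a b (f zero) (Disjoint-head A#B))
                 (weight-∪ (f ∘ suc) (Disjoint-tail A#B)) ⟩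
  ((if a then f zero else 0ℚ) + (if b then f zero else 0ℚ))
    + (weight (f ∘ suc) A + weight (f ∘ suc) B)
    ≡⟨ interchange (if a then f zero else 0ℚ) _ (weight (f ∘ suc) A) _ ⟩
  ((if a then f zero else 0ℚ) + weight (f ∘ suc) A)
    + ((if b then f zero else 0ℚ) + weight (f ∘ suc) B)
    ∎
  where open ≡-Reasoning

weight-∪-≤ : ∀ {n} (w : Fin n → ℚ) {A B : Subset n} {W : ℚ} → Disjoint A B →
             weight w B ≤ W - weight w A → weight w (A ∪ B) ≤ W
weight-∪-≤ w {A} {B} {W} A#B wB≤W-wA = begin
  weight w (A ∪ B)              ≡⟨ weight-∪ w A#B ⟩
  weight w A + weight w B       ≤⟨ QP.+-monoʳ-≤ (weight w A) wB≤W-wA ⟩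
  weight w A + (W - weight w A) ≡⟨ +-[-]-cancel (weight w A) W ⟩
  W                             ∎
  where open QP.≤-Reasoning

∨-∧-not-∨ : ∀ a b a' b' → a ∧ b' ≡ false → b ∧ a' ≡ false →
            (a ∨ b) ∧ not (a' ∨ b') ≡ (a ∧ not a') ∨ (b ∧ not b')
∨-∧-not-∨ true  _     _     true  () _
∨-∧-not-∨ _     true  true  _     _  ()
∨-∧-not-∨ true  true  false false _  _ = refl
∨-∧-not-∨ true  false true  false _  _ = refl
∨-∧-not-∨ true  false false false _  _ = refl
∨-∧-not-∨ false true  false b'    _  _ = refl
∨-∧-not-∨ false false _     _     _  _ = refl

∪-∩∁-distrib : ∀ {n} {A B A' B' : Subset n} → Disjoint A B' → Disjoint B A' →
               (A ∪ B) ∩ ∁ (A' ∪ B') ≡ (A ∩ ∁ A') ∪ (B ∩ ∁ B')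
∪-∩∁-distrib {A = []}    {[]}    {[]}     {[]}     _    _    = refl
∪-∩∁-distrib {A = a ∷ A} {b ∷ B} {a' ∷ A'} {b' ∷ B'} A#B' B#A' =
  cong₂ _∷_ (∨-∧-not-∨ a b a' b' (Disjoint-head A#B') (Disjoint-head B#A'))
            (∪-∩∁-distrib (Disjoint-tail A#B') (Disjoint-tail B#A'))

arrivals : ∀ {n T} → Seq n T → Fin T → Subset n
arrivals S t = S t ∩ ∁ (prev S t)

prev-∪ᶜ : ∀ {n T} (G R : Seq n T) t → prev (G ∪ᶜ R) t ≡ prev G t ∪ prev R t
prev-∪ᶜ G R zero    = sym (∪-identityˡ ⊥)
prev-∪ᶜ G R (suc t) = refl

Disjoint-prevʳ : ∀ {n T} {A : Subset n} {S : Seq n T} →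
                 (∀ τ → Disjoint A (S τ)) → ∀ t → Disjoint A (prev S t)
Disjoint-prevʳ A#S zero    _ = ∉⊥
Disjoint-prevʳ A#S (suc t)   = A#S _

arrivals-∪ᶜ : ∀ {n T} (G R : Seq n T) → (∀ t τ → Disjoint (R t) (G τ)) →
              ∀ t → arrivals (G ∪ᶜ R) t ≡ arrivals G t ∪ arrivals R t
arrivals-∪ᶜ G R R#G t = begin
  (G t ∪ R t) ∩ ∁ (prev (G ∪ᶜ R) t)
    ≡⟨ cong (λ P → (G t ∪ R t) ∩ ∁ P) (prev-∪ᶜ G R t) ⟩
  (G t ∪ R t) ∩ ∁ (prev G t ∪ prev R t)
    ≡⟨ ∪-∩∁-distrib (Disjoint-prevʳ (λ τ → Disjoint-sym (R#G τ t)) t)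
                    (Disjoint-prevʳ (R#G t) t) ⟩
  arrivals G t ∪ arrivals R t
    ∎
  where open ≡-Reasoning

profit-∪ᶜ : ∀ {n T} (D : Data n T) (G R : Seq n T) → (∀ t τ → Disjoint (R t) (G τ)) →
            profit D (G ∪ᶜ R) ≡ profit D G + profit D R
profit-∪ᶜ {n} {T} D G R R#G = begin
  sumFin (λ t → weight (profitAt t) (arrivals (G ∪ᶜ R) t))
    ≡⟨ sumFin-cong (λ t → cong (weight (profitAt t)) (arrivals-∪ᶜ G R R#G t)) ⟩
  sumFin (λ t → weight (profitAt t) (arrivals G t ∪ arrivals R t))
    ≡⟨ sumFin-cong (λ t → weight-∪ (profitAt t) (arrivals-disjoint t)) ⟩
  sumFin (λ t → weight (profitAt t) (arrivals G t) + weight (profitAt t) (arrivals R t))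
    ≡⟨ sumFin-distrib-+ (λ t → weight (profitAt t) (arrivals G t))
                       (λ t → weight (profitAt t) (arrivals R t)) ⟩
  profit D G + profit D R
    ∎
  where
  open ≡-Reasoning

  profitAt : Fin T → Fin n → ℚ
  profitAt t i = Data.p D i t

  arrivals-disjoint : ∀ t → Disjoint (arrivals G t) (arrivals R t)
  arrivals-disjoint t = Disjoint-mono (p∩q⊆p _ _) (p∩q⊆p _ _) (Disjoint-sym (R#G t t))

IsChain-∪ᶜ : ∀ {n T} {G R : Seq n T} → IsChain G → IsChain R → IsChain (G ∪ᶜ R)
IsChain-∪ᶜ {G = G} {R} chG chR t t' t≤t' =
  x∈p∪q⁺ ∘ map⊎ (chG t t' t≤t') (chR t t' t≤t') ∘ x∈p∪q⁻ (G t) (R t)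

residual-items-⊆ : ∀ {n T} (D : Data n T) (I : Instance n T) (G : Seq n T) →
                   Instance.items (residual D I G) ⊆ Instance.items I
residual-items-⊆ {T = ℕ.zero}  D I G i∈N = i∈N
residual-items-⊆ {T = ℕ.suc T} D I G     = p∩q⊆p _ _

residual-cap-≤ : ∀ {n T} (D : Data n T) (I : Instance n T) (G : Seq n T) t →
                 Instance.cap (residual D I G) t ≤ Instance.cap I t - weight (Data.w D) (G t)
residual-cap-≤ {T = ℕ.suc T} D I G t = minFrom-≤ _ t

residual-disjoint : ∀ {n T} (D : Data n T) (I : Instance n T) {G R : Seq n T} → IsChain G →
                    (∀ t → R t ⊆ Instance.items (residual D I G)) →
                    ∀ t τ → Disjoint (R t) (G τ)
residual-disjoint {T = ℕ.suc T} D I chG R⊆N⁻ t τ i∈R i∈G =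
  x∈∁p⇒x∉p (proj₂ (x∈p∩q⁻ _ _ (R⊆N⁻ t i∈R))) (chG τ (fromℕ T) (≤fromℕ τ) i∈G)

lemma8 : ∀ {n T} (D : Data n T) (I : Instance n T) (G R : Seq n T)
           → CapMonotone I
           → Feasible D I G
           → Feasible D (residual D I G) R
           → Feasible D I (G ∪ᶜ R)
             × profit D (G ∪ᶜ R) ≡ profit D G + profit D R
lemma8 D I G R _ (chG , G⊆N , _) (chR , R⊆N⁻ , wR≤W⁻) =
  (IsChain-∪ᶜ chG chR , items-⊆ , weight-≤) , profit-∪ᶜ D G R R#G
  where
  R#G : ∀ t τ → Disjoint (R t) (G τ)
  R#G = residual-disjoint D I chG R⊆N⁻

  items-⊆ : ∀ t → G t ∪ R t ⊆ Instance.items I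
  items-⊆ t = ∪-lub (G⊆N t) (residual-items-⊆ D I G ∘ R⊆N⁻ t)

  weight-≤ : ∀ t → weight (Data.w D) (G t ∪ R t) ≤ Instance.cap I t
  weight-≤ t = weight-∪-≤ (Data.w D) (Disjoint-sym (R#G t t))
                 (QP.≤-trans (wR≤W⁻ t) (residual-cap-≤ D I G t))
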